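{- For every graph $G$, $\mathrm{bcw}_1(G)\le 2c_0(G)$.
   Context: All graphs are finite, simple and undirected. In the zero-visibility cops and robber game on $G$, the cops choose initial vertices, then the robber chooses an initial vertex; afterwards cops and robber alternate moves, each cop and the robber moving to an adjacent vertex or staying. The cops never see the robber. The robber is captured when on the same vertex as a cop. $c_0(G)$ is the minimum number of cops with a strategy guaranteeing capture in finitely many steps. For radius-$1$ blind cop-width: a blind strategy is a sequence $C_1,\dots,C_m\subseteq V(G)$ using $\max_i|C_i|$ cops, with $A_1=V(G)\setminus C_1$ and $A_{i+1}$ the set of $u\in V(G)\setminus C_{i+1}$ reachable from some vertex of $A_i$ by a path of length at most $1$ (length $0$ allowed) in $G\setminus(C_i\cap C_{i+1})$; it is winning if $A_m=\emptyset$. $\mathrm{bcw}_1(G)$ is the minimum number of cops of a winning strategy. -}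

module Defs where

open import Data.Nat using (ℕ; zero; suc; _≤_; _<_)
open import Data.Fin using (Fin)
open import Data.Bool using (Bool; true; false; T)
open import Data.Fin.Subset using (Subset; _∈_; _∉_; _∩_; ∣_∣)
open import Data.Product using (Σ; ∃; _×_; _,_)
open import Data.Sum using (_⊎_)
open import Relation.Nullary using (¬_)
open import Relation.Binary.PropositionalEquality using (_≡_)

record Graph : Set where
  field
    n      : ℕ
    adj    : Fin n → Fin n → Bool
    sym    : ∀ u v → adj u v ≡ adj v u
    irrefl : ∀ u → adj u u ≡ false

module _ (G : Graph) where
  open Graph G

  V : Set
  V = Fin n

  Adj : V → V → Set
  Adj u v = T (adj u v)

  Step : V → V → Set
  Step u v = u ≡ v ⊎ Adj u v

  -- Zero-visibility cops and robber.
  -- Since the cops never see the robber, a cop strategy is a fixed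
  -- sequence of configurations pos 0, pos 1, ..., pos len of k cops.
  record ZStrategy (k : ℕ) : Set where
    field
      len   : ℕ
      pos   : ℕ → Fin k → V
      moves : ∀ t → t < len → ∀ (i : Fin k) → Step (pos t i) (pos (suc t) i)

  RobberWalk : ℕ → (ℕ → V) → Set
  RobberWalk len r = ∀ t → t < len → Step (r t) (r (suc t))

  -- Round t: cops at pos t, robber at r t; cops move to pos (suc t)
  -- (capture if a cop lands on r t); then the robber moves to r (suc t).
  Captured : ∀ {k} → ZStrategy k → (ℕ → V) → Set
  Captured {k} S r =
    Σ ℕ λ t → t ≤ ZStrategy.len S × Σ (Fin k) λ i →
      (ZStrategy.pos S t i ≡ r t) ⊎ (t < ZStrategy.len S × ZStrategy.pos S (suc t) i ≡ r t)

  ZWinning : ∀ {k} → ZStrategy k → Set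
  ZWinning S = ∀ r → RobberWalk (ZStrategy.len S) r → Captured S r

  ZeroVisWin : ℕ → Set
  ZeroVisWin k = Σ (ZStrategy k) ZWinning

  IsC0 : ℕ → Set
  IsC0 c = ZeroVisWin c × (∀ k → ZeroVisWin k → c ≤ k)

  -- Radius-1 blind cop-width.
  -- A blind strategy C₁,…,C_m (m ≥ 1) is encoded as m = suc len and
  -- C_{i+1} = C i for i = 0,…,len.
  record BStrategy : Set where
    field
      len : ℕ
      C   : ℕ → Subset n

  -- Contaminated sets: A S i encodes A_{i+1}.
  A : BStrategy → ℕ → V → Set
  A S zero    u = u ∉ BStrategy.C S zero
  A S (suc i) u =
    u ∉ BStrategy.C S (suc i) ×
    Σ V λ w → A S i w ×
      -- path of length ≤ 1 from w to u in G ∖ (C_i ∩ C_{i+1})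
      (w ∉ (BStrategy.C S i ∩ BStrategy.C S (suc i)) ×
       u ∉ (BStrategy.C S i ∩ BStrategy.C S (suc i)) ×
       (w ≡ u ⊎ Adj w u))

  UsesAtMost : ℕ → BStrategy → Set
  UsesAtMost b S = ∀ i → i ≤ BStrategy.len S → ∣ BStrategy.C S i ∣ ≤ b

  BWinning : BStrategy → Set
  BWinning S = ∀ u → ¬ A S (BStrategy.len S) u

  BlindWin : ℕ → Set
  BlindWin b = Σ BStrategy λ S → UsesAtMost b S × BWinning S

  IsBcw1 : ℕ → Set
  IsBcw1 b = BlindWin b × (∀ b' → BlindWin b' → b ≤ b')

module Submission where

-- A zero-visibility strategy with k cops yields a blind strategy with 2k cops by letting the
-- t-th cop set be the union of the cops' positions in rounds t and t + 1. Every vertex that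
-- is still contaminated at some stage of this blind strategy is the end of a robber walk that
-- avoided every cop set so far; such a walk is never captured by the zero-visibility
-- strategy, so a winning zero-visibility strategy leaves no contaminated vertex at the end.

open import Defs
open import Data.Nat using (ℕ; _≤_; _*_; zero; suc; _+_; z≤n; s≤s; _≤?_)
open import Data.Nat.Properties
  using (≤-trans; ≤-reflexive; +-suc; +-identityʳ; +-mono-≤; ≤-refl; m≤n⇒m≤1+n; m≤n⇒m<n∨m≡n; 1+n≰n)
open import Data.Bool using (true; false)
open import Data.Vec using (_∷_; [])
open import Data.Fin using (Fin)
import Data.Fin as Fin
open import Data.Fin.Subset using (Subset; _∈_; _∉_; _∪_; ⁅_⁆; ∣_∣; ⊥)
open import Data.Fin.Subset.Properties using (x∈⁅x⁆; ∣⁅x⁆∣≡1; ∣⊥∣≡0; x∈p∪q⁺)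
open import Data.Product using (Σ; _×_; _,_)
open import Data.Sum using (inj₁; inj₂)
open import Relation.Nullary using (yes; no; contradiction)
open import Relation.Binary.PropositionalEquality using (_≡_; refl; sym; subst; cong)

∣p∪q∣≤∣p∣+∣q∣ : ∀ {n} (p q : Subset n) → ∣ p ∪ q ∣ ≤ ∣ p ∣ + ∣ q ∣
∣p∪q∣≤∣p∣+∣q∣ []         []         = z≤n
∣p∪q∣≤∣p∣+∣q∣ (true ∷ p)  (true ∷ q)  =
  s≤s (≤-trans (m≤n⇒m≤1+n (∣p∪q∣≤∣p∣+∣q∣ p q)) (≤-reflexive (sym (+-suc _ _))))
∣p∪q∣≤∣p∣+∣q∣ (true ∷ p)  (false ∷ q) = s≤s (∣p∪q∣≤∣p∣+∣q∣ p q)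
∣p∪q∣≤∣p∣+∣q∣ (false ∷ p) (true ∷ q)  =
  ≤-trans (s≤s (∣p∪q∣≤∣p∣+∣q∣ p q)) (≤-reflexive (sym (+-suc _ _)))
∣p∪q∣≤∣p∣+∣q∣ (false ∷ p) (false ∷ q) = ∣p∪q∣≤∣p∣+∣q∣ p q

image : ∀ {n} k → (Fin k → Fin n) → Subset n
image zero    f = ⊥
image (suc k) f = ⁅ f Fin.zero ⁆ ∪ image k (λ i → f (Fin.suc i))

∣image∣≤k : ∀ {n} k (f : Fin k → Fin n) → ∣ image k f ∣ ≤ k
∣image∣≤k {n} zero f = ≤-reflexive (∣⊥∣≡0 n)
∣image∣≤k (suc k) f = ≤-trans (∣p∪q∣≤∣p∣+∣q∣ ⁅ f Fin.zero ⁆ _)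
  (subst (λ m → m + ∣ image k (λ i → f (Fin.suc i)) ∣ ≤ suc k) (sym (∣⁅x⁆∣≡1 (f Fin.zero)))
    (s≤s (∣image∣≤k k _)))

f[i]∈image : ∀ {n} k (f : Fin k → Fin n) i → f i ∈ image k f
f[i]∈image (suc k) f Fin.zero    = x∈p∪q⁺ (inj₁ (x∈⁅x⁆ _))
f[i]∈image (suc k) f (Fin.suc i) = x∈p∪q⁺ (inj₂ (f[i]∈image k (λ j → f (Fin.suc j)) i))

extendAfter : ∀ {a} {X : Set a} → (ℕ → X) → ℕ → X → ℕ → X
extendAfter r i x t with t ≤? i
... | yes _ = r t
... | no  _ = x

extendAfter-≤ : ∀ {a} {X : Set a} (r : ℕ → X) {i x t} → t ≤ i → extendAfter r i x t ≡ r t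
extendAfter-≤ r {i} {t = t} t≤i with t ≤? i
... | yes _   = refl
... | no  t≰i = contradiction t≤i t≰i

extendAfter-suc : ∀ {a} {X : Set a} (r : ℕ → X) i {x} → extendAfter r i x (suc i) ≡ x
extendAfter-suc r i with suc i ≤? i
... | yes i+1≤i = contradiction i+1≤i 1+n≰n
... | no  _     = refl

module _ (G : Graph) where
  open BStrategy using (C)

  record EvadingWalk (S : BStrategy G) (i : ℕ) (u : V G) : Set where
    field
      walk   : ℕ → V G
      ends   : walk i ≡ u
      steps  : RobberWalk G i walk
      evades : ∀ t → t ≤ i → walk t ∉ C S t

  contaminated⇒evadingWalk : ∀ (S : BStrategy G) i u → A G S i u → EvadingWalk S i u
  contaminated⇒evadingWalk S zero u u∉C₀ = record
    { walk = λ _ → u ; ends = refl ; steps = λ _ () ; evades = λ { zero _ → u∉C₀ } }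
  contaminated⇒evadingWalk S (suc i) u (u∉C , w , w∈A , _ , _ , w→u) = record
    { walk = r′ ; ends = extendAfter-suc walk i ; steps = steps′ ; evades = evades′ }
    where
    open EvadingWalk (contaminated⇒evadingWalk S i w w∈A)
    r′ : ℕ → V G
    r′ = extendAfter walk i u

    steps′ : RobberWalk G (suc i) r′
    steps′ t (s≤s t≤i) with m≤n⇒m<n∨m≡n t≤i
    ... | inj₁ t<i  rewrite extendAfter-≤ walk {x = u} t≤i | extendAfter-≤ walk {x = u} t<i = steps t t<i
    ... | inj₂ refl rewrite extendAfter-≤ walk {x = u} (≤-refl {t}) | extendAfter-suc walk t {u} | ends = w→u

    evades′ : ∀ t → t ≤ suc i → r′ t ∉ C S t
    evades′ t t≤1+i with m≤n⇒m<n∨m≡n t≤1+i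
    ... | inj₁ (s≤s t≤i) rewrite extendAfter-≤ walk {x = u} t≤i = evades t t≤i
    ... | inj₂ refl      rewrite extendAfter-suc walk i {u} = u∉C

  module _ {k : ℕ} (S : ZStrategy G k) where
    open ZStrategy S

    toBlind : BStrategy G
    toBlind = record { len = len ; C = λ t → image k (pos t) ∪ image k (pos (suc t)) }

    toBlind-usesAtMost-2k : UsesAtMost G (2 * k) toBlind
    toBlind-usesAtMost-2k t _ = begin
      ∣ image k (pos t) ∪ image k (pos (suc t)) ∣ ≤⟨ ∣p∪q∣≤∣p∣+∣q∣ (image k (pos t)) _ ⟩
      ∣ image k (pos t) ∣ + ∣ image k (pos (suc t)) ∣ ≤⟨ +-mono-≤ (∣image∣≤k k (pos t)) (∣image∣≤k k _) ⟩
      k + k                                          ≡⟨ cong (k +_) (sym (+-identityʳ k)) ⟩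
      2 * k                                          ∎
      where open Data.Nat.Properties.≤-Reasoning

    captured⇒inCopSet : ∀ r → Captured G S r → Σ ℕ λ t → t ≤ len × r t ∈ C toBlind t
    captured⇒inCopSet r (t , t≤len , i , inj₁ pos≡r) =
      t , t≤len , subst (_∈ C toBlind t) pos≡r (x∈p∪q⁺ (inj₁ (f[i]∈image k (pos t) i)))
    captured⇒inCopSet r (t , t≤len , i , inj₂ (_ , pos≡r)) =
      t , t≤len , subst (_∈ C toBlind t) pos≡r (x∈p∪q⁺ (inj₂ (f[i]∈image k (pos (suc t)) i)))

    toBlind-winning : ZWinning G S → BWinning G toBlind
    toBlind-winning win u u∈A =
      let t , t≤len , walk[t]∈C = captured⇒inCopSet walk (win walk steps) in evades t t≤len walk[t]∈C
      where open EvadingWalk (contaminated⇒evadingWalk toBlind len u u∈A)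

proposition7p5 : (G : Graph) (c b : ℕ) → IsC0 G c → IsBcw1 G b → b ≤ 2 * c
proposition7p5 G c b ((S , win) , _) (_ , bcw₁-minimal) =
  bcw₁-minimal (2 * c) (toBlind G S , toBlind-usesAtMost-2k G S , toBlind-winning G S win)
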